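{- (Provably in $\mathrm{EA}$.) Let $A$ be a worm over $\omega\cdot2$ all of whose entries are $\ge1$, and let $n$ be a natural number. If $h_{1A}(n)$ is defined, then $h_{1A}(n)>h_A^{(n)}(n)$, where $h_A^{(n)}$ is the $n$-fold iterate of $h_A$.
   Context: Worms over $\omega\cdot2$: finite possibly empty sequences of ordinals $<\omega\cdot2$, empty worm $\top$, concatenation $AB$ (so $1A$ is $A$ preceded by the entry $1$), $C^k$ $k$-fold concatenation. $h_\alpha(\top)=\top$, $h_\alpha(\beta A)=\top$ if $\beta<\alpha$, else $\beta h_\alpha(A)$; $r_\alpha(\top)=\top$, $r_\alpha(\beta A)=\beta A$ if $\beta<\alpha$, else $r_\alpha(A)$. Step-down: $\top\llbracket k\rrbracket=\top$, $(0B)\llbracket k\rrbracket=B$, $((\alpha+1)B)\llbracket k\rrbracket=(\alpha\,h_{\alpha+1}(B))^{k+1}r_{\alpha+1}(B)$, $(\omega B)\llbracket k\rrbracket=kB$. $h_A(m)$ is the least $k$ with $A\llbracket m\rrbracket\llbracket m+1\rrbracket\cdots\llbracket m+k\rrbracket=\top$ (undefined if none). -}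

module Defs where

open import Data.Nat using (ℕ; zero; suc; _+_; _<_)
open import Data.Bool using (Bool; true; false; if_then_else_)
open import Data.List using (List; []; _∷_; _++_)
open import Data.Product using (Σ; _×_)
open import Relation.Binary.PropositionalEquality using (_≡_; _≢_)

-- Ordinals below ω·2 : either a finite ordinal n, or ω + n.
data Ord : Set where
  fin : ℕ → Ord
  ω+  : ℕ → Ord

_<ᵇₒ_ : Ord → Ord → Bool
fin m <ᵇₒ fin n = Data.Nat._<ᵇ_ m n
fin m <ᵇₒ ω+ n  = true
ω+ m  <ᵇₒ fin n = false
ω+ m  <ᵇₒ ω+ n  = Data.Nat._<ᵇ_ m n

data _<ₒ_ : Ord → Ord → Set where
  fin<fin : ∀ {m n} → m < n → fin m <ₒ fin n
  fin<ω+  : ∀ {m n} → fin m <ₒ ω+ n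
  ω+<ω+   : ∀ {m n} → m < n → ω+ m <ₒ ω+ n

Worm : Set
Worm = List Ord

⊤w : Worm
⊤w = []

hw : Ord → Worm → Worm
hw α [] = []
hw α (β ∷ A) = if β <ᵇₒ α then [] else (β ∷ hw α A)

rw : Ord → Worm → Worm
rw α [] = []
rw α (β ∷ A) = if β <ᵇₒ α then β ∷ A else rw α A

pow : Worm → ℕ → Worm
pow C zero = []
pow C (suc k) = C ++ pow C k

_⟦_⟧ : Worm → ℕ → Worm
[] ⟦ k ⟧ = []
(fin zero ∷ B) ⟦ k ⟧ = B
(fin (suc a) ∷ B) ⟦ k ⟧ =
  pow (fin a ∷ hw (fin (suc a)) B) (suc k) ++ rw (fin (suc a)) B
(ω+ zero ∷ B) ⟦ k ⟧ = fin k ∷ B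
(ω+ (suc a) ∷ B) ⟦ k ⟧ =
  pow (ω+ a ∷ hw (ω+ (suc a)) B) (suc k) ++ rw (ω+ (suc a)) B

steps : Worm → ℕ → ℕ → Worm
steps A m zero = A ⟦ m ⟧
steps A m (suc k) = steps A m k ⟦ m + suc k ⟧

HasH : Worm → ℕ → ℕ → Set
HasH A m k = (steps A m k ≡ []) × (∀ j → j < k → steps A m j ≢ [])

data IterH (A : Worm) : ℕ → ℕ → ℕ → Set where
  iter-zero : ∀ {m} → IterH A zero m m
  iter-suc  : ∀ {i m u v} → IterH A i m u → HasH A u v → IterH A (suc i) m v

-- (1A)⟦n⟧ = (0A)^{n+1}, because every entry of A is ≥ 1. A step-down of a worm X0B with X
-- nonempty only changes X, so the descent destroys the copies of A one after another, each
-- separating 0 costing one more step. If the current iterate is w and a copy of A starts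
-- its descent at an index m ≥ w, it survives at least h_A(m) + 1 ≥ h_A(w) + 1 steps, so the
-- next copy starts at an index beyond h_A(w); after n copies more than h_A^{(n)}(n) steps
-- have passed. The monotonicity of h_A is the heart of the matter: A⟦k+1⟧ reaches A⟦k⟧ by
-- ⟦0⟧-steps, and ⟦0⟧-descendants of a worm die no later than the worm itself.
module Submission where

open import Defs
open import Data.Nat using (ℕ; _<_)
open import Data.List using (_∷_)
open import Data.List.Relation.Unary.All using (All)
open import Data.Product using (Σ; _×_)

open import Data.Nat using (zero; suc; _+_; _≤_; _≤′_; ≤′-refl; ≤′-step; z≤n; s≤s)
open import Data.Nat.Properties
  using (≤-refl; ≤-trans; ≤-<-trans; <-trans; n≤1+n; m≤n⇒m≤1+n; m<n⇒m<1+n; m≤m+n; m≤n+m; m<m+n;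
         +-suc; +-comm; +-identityʳ; ≤⇒≤′)
open import Data.List using ([]; _++_)
open import Data.List.Properties using (++-assoc; ++-identityʳ)
open import Data.List.Relation.Unary.All using ([]; _∷_)
open import Data.Product using (_,_)
open import Data.Bool using (true; false)
open import Relation.Binary.Construct.Closure.ReflexiveTransitive using (Star; ε; _◅_; _◅◅_)
open import Relation.Binary.PropositionalEquality using (_≡_; _≢_; refl; sym; trans; cong; subst)

descend : Worm → ℕ → ℕ → Worm
descend W m zero    = W
descend W m (suc N) = descend (W ⟦ m ⟧) (suc m) N

Dies : Worm → ℕ → ℕ → Set
Dies W m N = descend W m N ≡ []

descend-[] : ∀ m N → descend [] m N ≡ []
descend-[] m zero    = refl
descend-[] m (suc N) = descend-[] (suc m) N

Dies-mono : ∀ W m {N N′} → N ≤ N′ → Dies W m N → Dies W m N′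
Dies-mono W m {N′ = N′} z≤n        refl = descend-[] m N′
Dies-mono W m (s≤s N≤N′)           dies = Dies-mono (W ⟦ m ⟧) (suc m) N≤N′ dies

descend-suc : ∀ W m k → descend W m (suc k) ≡ descend W m k ⟦ m + k ⟧
descend-suc W m zero    = cong (W ⟦_⟧) (sym (+-identityʳ m))
descend-suc W m (suc k) =
  trans (descend-suc (W ⟦ m ⟧) (suc m) k) (cong (descend (W ⟦ m ⟧) (suc m) k ⟦_⟧) (sym (+-suc m k)))

steps≡descend : ∀ W m k → steps W m k ≡ descend W m (suc k)
steps≡descend W m zero    = refl
steps≡descend W m (suc k) = trans (cong (_⟦ m + suc k ⟧) (steps≡descend W m k)) (sym (descend-suc W m (suc k)))

HasH-≤ : ∀ A u M → Dies A u (suc M) → Σ ℕ λ v → HasH A u v × v ≤ M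
HasH-≤ A u zero dies = 0 , (dies , λ _ ()) , z≤n
HasH-≤ A u (suc M) dies with descend A u (suc M) in eq
... | [] = let v , h , v≤M = HasH-≤ A u M eq in v , h , m≤n⇒m≤1+n v≤M
... | _ ∷ _ = suc M , (trans (steps≡descend A u (suc M)) dies , alive) , ≤-refl
  where
    alive : ∀ j → j < suc M → steps A u j ≢ []
    alive j j<1+M died with trans (sym eq) (Dies-mono A u j<1+M (trans (sym (steps≡descend A u j)) died))
    ... | ()

_⟶₀_ : Worm → Worm → Set
Y ⟶₀ X = Y ⟦ 0 ⟧ ≡ X

_⟶₀*_ : Worm → Worm → Set
_⟶₀*_ = Star _⟶₀_

⟶₀*-[] : ∀ {Y X} → Y ⟶₀* X → Y ≡ [] → X ≡ []
⟶₀*-[] ε          Y≡[] = Y≡[]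
⟶₀*-[] (refl ◅ p) refl = ⟶₀*-[] p refl

hw++rw : ∀ α B → hw α B ++ rw α B ≡ B
hw++rw α [] = refl
hw++rw α (β ∷ B) with β <ᵇₒ α
... | true  = refl
... | false = cong (β ∷_) (hw++rw α B)

pow-1-hw++rw : ∀ α β B → pow (β ∷ hw α B) 1 ++ rw α B ≡ β ∷ B
pow-1-hw++rw α β B = cong (β ∷_) (trans (cong (_++ rw α B) (++-identityʳ (hw α B))) (hw++rw α B))

∷-⟶₀* : ∀ β Z → (β ∷ Z) ⟶₀* Z
∷-⟶₀* (fin zero)    Z = refl ◅ ε
∷-⟶₀* (fin (suc a)) Z = pow-1-hw++rw (fin (suc a)) (fin a) Z ◅ ∷-⟶₀* (fin a) Z
∷-⟶₀* (ω+ zero)     Z = refl ◅ refl ◅ ε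
∷-⟶₀* (ω+ (suc a))  Z = pow-1-hw++rw (ω+ (suc a)) (ω+ a) Z ◅ ∷-⟶₀* (ω+ a) Z

++-⟶₀* : ∀ H Z → (H ++ Z) ⟶₀* Z
++-⟶₀* []      Z = ε
++-⟶₀* (β ∷ H) Z = ∷-⟶₀* β (H ++ Z) ◅◅ ++-⟶₀* H Z

pow-suc-⟶₀* : ∀ C k R → (pow C (suc (suc k)) ++ R) ⟶₀* (pow C (suc k) ++ R)
pow-suc-⟶₀* C k R =
  subst (_⟶₀* (pow C (suc k) ++ R)) (sym (++-assoc C (pow C (suc k)) R)) (++-⟶₀* C (pow C (suc k) ++ R))

⟦suc⟧-⟶₀* : ∀ Y k → (Y ⟦ suc k ⟧) ⟶₀* (Y ⟦ k ⟧)
⟦suc⟧-⟶₀* []                k = ε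
⟦suc⟧-⟶₀* (fin zero ∷ B)    k = ε
⟦suc⟧-⟶₀* (fin (suc a) ∷ B) k = pow-suc-⟶₀* (fin a ∷ hw (fin (suc a)) B) k (rw (fin (suc a)) B)
⟦suc⟧-⟶₀* (ω+ zero ∷ B)     k = pow-1-hw++rw (fin (suc k)) (fin k) B ◅ ε
⟦suc⟧-⟶₀* (ω+ (suc a) ∷ B)  k = pow-suc-⟶₀* (ω+ a ∷ hw (ω+ (suc a)) B) k (rw (ω+ (suc a)) B)

⟦⟧-⟶₀*-⟦0⟧ : ∀ Y m → (Y ⟦ m ⟧) ⟶₀* (Y ⟦ 0 ⟧)
⟦⟧-⟶₀*-⟦0⟧ Y zero    = ε
⟦⟧-⟶₀*-⟦0⟧ Y (suc m) = ⟦suc⟧-⟶₀* Y m ◅◅ ⟦⟧-⟶₀*-⟦0⟧ Y m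

mutual
  Dies-⟶₀* : ∀ N {Y X} m → Y ⟶₀* X → Dies Y m N → Dies X m N
  Dies-⟶₀* zero    m p          dies = ⟶₀*-[] p dies
  Dies-⟶₀* (suc N) m ε          dies = dies
  Dies-⟶₀* (suc N) {Y} {X} m (refl ◅ p) dies =
    Dies-mono X m (n≤1+n N) (Dies-start-pred N X m (Dies-⟶₀* N (suc m) (⟦⟧-⟶₀*-⟦0⟧ Y m ◅◅ p) dies))

  Dies-start-pred : ∀ N X m → Dies X (suc m) N → Dies X m N
  Dies-start-pred zero    X m dies = dies
  Dies-start-pred (suc N) X m dies =
    Dies-start-pred N (X ⟦ m ⟧) (suc m) (Dies-⟶₀* N (suc (suc m)) (⟦suc⟧-⟶₀* X m) dies)

Dies-start-≤ : ∀ X N {w m} → w ≤ m → Dies X m N → Dies X w N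
Dies-start-≤ X N w≤m = go (≤⇒≤′ w≤m)
  where
    go : ∀ {w m} → w ≤′ m → Dies X m N → Dies X w N
    go ≤′-refl        dies = dies
    go (≤′-step w≤′m) dies = go w≤′m (Dies-start-pred N X _ dies)

hw-++0∷ : ∀ α X B → fin 0 <ᵇₒ α ≡ true → hw α (X ++ fin 0 ∷ B) ≡ hw α X
hw-++0∷ α [] B 0<α rewrite 0<α = refl
hw-++0∷ α (β ∷ X) B 0<α with β <ᵇₒ α
... | true  = refl
... | false = cong (β ∷_) (hw-++0∷ α X B 0<α)

rw-++0∷ : ∀ α X B → fin 0 <ᵇₒ α ≡ true → rw α (X ++ fin 0 ∷ B) ≡ rw α X ++ fin 0 ∷ B
rw-++0∷ α [] B 0<α rewrite 0<α = refl
rw-++0∷ α (β ∷ X) B 0<α with β <ᵇₒ α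
... | true  = refl
... | false = rw-++0∷ α X B 0<α

⟦⟧-++0∷ : ∀ β X B k → ((β ∷ X) ++ fin 0 ∷ B) ⟦ k ⟧ ≡ (β ∷ X) ⟦ k ⟧ ++ fin 0 ∷ B
⟦⟧-++0∷ (fin zero)    X B k = refl
⟦⟧-++0∷ (fin (suc a)) X B k
  rewrite hw-++0∷ (fin (suc a)) X B refl | rw-++0∷ (fin (suc a)) X B refl
  = sym (++-assoc (pow (fin a ∷ hw (fin (suc a)) X) (suc k)) (rw (fin (suc a)) X) (fin 0 ∷ B))
⟦⟧-++0∷ (ω+ zero)     X B k = refl
⟦⟧-++0∷ (ω+ (suc a))  X B k
  rewrite hw-++0∷ (ω+ (suc a)) X B refl | rw-++0∷ (ω+ (suc a)) X B refl
  = sym (++-assoc (pow (ω+ a ∷ hw (ω+ (suc a)) X) (suc k)) (rw (ω+ (suc a)) X) (fin 0 ∷ B))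

Dies-++0∷ : ∀ X B {m T} → Dies (X ++ fin 0 ∷ B) m T →
  Σ ℕ λ t → Σ ℕ λ s → Dies X m t × Dies B (suc (t + m)) s × t + suc s ≡ T
Dies-++0∷ []      B {T = suc T} dies = 0 , T , refl , dies , refl
Dies-++0∷ (β ∷ X) B {m} {suc T} dies
  with Dies-++0∷ ((β ∷ X) ⟦ m ⟧) B (subst (λ W → Dies W (suc m) T) (⟦⟧-++0∷ β X B m) dies)
... | t , s , diesX , diesB , T≡ =
  suc t , s , diesX , subst (λ i → Dies B (suc i) s) (+-suc t m) diesB , cong suc T≡

iterH-++0∷ : ∀ {A n i w m T} B → IterH A i n w → w ≤ m → Dies (A ++ fin 0 ∷ B) m T →
  Σ ℕ λ v → IterH A (suc i) n v × Σ ℕ λ t → v ≤ t × Σ ℕ λ s → Dies B (suc (t + m)) s × t + suc s ≡ T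
iterH-++0∷ {A} {w = w} B it w≤m dies =
  let t , s , diesA , diesB , T≡ = Dies-++0∷ A B dies
      v , hasH , v≤t = HasH-≤ A w t (Dies-mono A w (n≤1+n t) (Dies-start-≤ A t w≤m diesA))
  in v , iter-suc it hasH , t , v≤t , s , diesB , T≡

chain : Worm → ℕ → Worm
chain A j = A ++ pow (fin 0 ∷ A) j

-- The 0 after the last copy of A, not that copy, makes the bound strict.
chain-iterH : ∀ {A n} j {i w m T} → IterH A i n w → w ≤ m → Dies (chain A (suc j)) m T →
  Σ ℕ λ v → IterH A (i + suc j) n v × v < T
chain-iterH {A} {n} zero {i} it w≤m dies =
  let v , itᵥ , t , v≤t , s , _ , T≡ = iterH-++0∷ (chain A 0) it w≤m dies
  in v , subst (λ k → IterH A k n v) (+-comm 1 i) itᵥ ,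
     ≤-<-trans v≤t (subst (t <_) T≡ (m<m+n t (s≤s z≤n)))
chain-iterH {A} {n} (suc j) {i} {m = m} it w≤m dies =
  let v , itᵥ , t , v≤t , s , diesRest , T≡ = iterH-++0∷ (chain A (suc j)) it w≤m dies
      u , itᵤ , u<s = chain-iterH j itᵥ (m≤n⇒m≤1+n (≤-trans v≤t (m≤m+n t m))) diesRest
  in u , subst (λ k → IterH A k n u) (sym (+-suc i (suc j))) itᵤ ,
     <-trans u<s (subst (s <_) T≡ (m≤n+m (suc s) t))

hw-1 : ∀ A → All (fin 0 <ₒ_) A → hw (fin 1) A ≡ A
hw-1 []                _         = refl
hw-1 (fin zero ∷ A)    (fin<fin () ∷ _)
hw-1 (fin (suc a) ∷ A) (_ ∷ A≥1) = cong (fin (suc a) ∷_) (hw-1 A A≥1)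
hw-1 (ω+ a ∷ A)        (_ ∷ A≥1) = cong (ω+ a ∷_) (hw-1 A A≥1)

rw-1 : ∀ A → All (fin 0 <ₒ_) A → rw (fin 1) A ≡ []
rw-1 []                _         = refl
rw-1 (fin zero ∷ A)    (fin<fin () ∷ _)
rw-1 (fin (suc a) ∷ A) (_ ∷ A≥1) = rw-1 A A≥1
rw-1 (ω+ a ∷ A)        (_ ∷ A≥1) = rw-1 A A≥1

1∷-⟦⟧ : ∀ A → All (fin 0 <ₒ_) A → ∀ n → (fin 1 ∷ A) ⟦ n ⟧ ≡ fin 0 ∷ chain A n
1∷-⟦⟧ A A≥1 n rewrite hw-1 A A≥1 | rw-1 A A≥1 = ++-identityʳ (pow (fin 0 ∷ A) (suc n))

0∷chain-iterH : ∀ A n k → Dies (fin 0 ∷ chain A n) (suc n) k → Σ ℕ λ v → IterH A n n v × v < k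
0∷chain-iterH A zero    (suc k) _    = 0 , iter-zero , s≤s z≤n
0∷chain-iterH A (suc j) (suc k) dies =
  let v , it , v<k = chain-iterH j iter-zero (≤-trans (n≤1+n (suc j)) (n≤1+n (suc (suc j)))) dies
  in v , it , m<n⇒m<1+n v<k

corollary5 : (A : Worm) → All (λ β → fin 0 <ₒ β) A → (n k : ℕ) →
    HasH (fin 1 ∷ A) n k → Σ ℕ (λ v → IterH A n n v × (v < k))
corollary5 A A≥1 n k (died , _) = 0∷chain-iterH A n k dies
  where
    dies : Dies (fin 0 ∷ chain A n) (suc n) k
    dies = subst (λ W → Dies W (suc n) k) (1∷-⟦⟧ A A≥1 n) (trans (sym (steps≡descend (fin 1 ∷ A) n k)) died)
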